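{- Let \(g = ([G], L, R, P, F)\) be a morphism in the prop of graphs and \(d\) be a monoidal decomposition of \(g\). Let \(\Gamma = (G, (L \mid R))\). Then there is an inductive rank decomposition \(T\) of \(\Gamma\) such that \(\mathrm{width}(T) \leq 2 \cdot \max\{\mathrm{width}(d), \operatorname{rank}(L), \operatorname{rank}(R)\}\).
   Context: The prop of graphs is the prop obtained from the prop of bialgebras (isomorphic to the prop of matrices over \(\mathbb{N}\)) by adding a cup \(0 \to 2\) and a vertex generator \(1 \to 0\) with suitable equations; it is isomorphic to the prop of graphs with boundaries, whose morphisms \(n \to m\) are tuples \(([G], L, R, P, F)\) with \(G \in \mathrm{Mat}_{\mathbb{N}}(k,k)\) an adjacency matrix of a graph on \(k\) vertices (up to \([G]=[H]\) iff \(G + G^{T} = H + H^{T}\)), \(L \in \mathrm{Mat}_{\mathbb{N}}(k,n)\) and \(R \in \mathrm{Mat}_{\mathbb{N}}(k,m)\) recording connections of vertices to the left and right boundaries, \(P \in \mathrm{Mat}_{\mathbb{N}}(m,n)\) recording passing wires, and \(F \in \mathrm{Mat}_{\mathbb{N}}(m,m)\) recording wires from the right boundary to itself, all up to permutation of the vertices. A monoidal decomposition of a morphism is a binary tree whose leaves are labelled by atomic morphisms and whose internal nodes are labelled by \(\otimes\) or by composition \(;_X\) along an object \(X\), evaluating to the morphism. Here all morphisms are atomic, the weight of an atom is its number of vertices, and the weight of an object \(n\) is \(n\). The width of a decomposition is: for a leaf, the weight of its atom; for a \(\otimes\)-node, the maximum width of its children; for a \(;_X\)-node, the maximum of the widths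 of its children and the weight of \(X\). A graph with dangling edges \((G,B)\) is an adjacency matrix \(G \in \mathrm{Mat}_{\mathbb{N}}(k,k)\) with a boundary matrix \(B \in \mathrm{Mat}_{\mathbb{N}}(k,n)\). An inductive rank decomposition of \(\Gamma = (G,B)\) is a binary tree labelled by nonempty subgraphs of \(\Gamma\): empty if \(\Gamma\) is empty; a leaf labelled \(\Gamma\) if \(\Gamma\) has one vertex; or a root \(\Gamma\) with subtrees \(T_1,T_2\) decomposing subgraphs \(\Gamma_i=(G_i,B_i)\) with \([G] = \left[\begin{pmatrix} G_1 & C \\ 0 & G_2\end{pmatrix}\right]\), \(B = \begin{pmatrix} A_1 \\ A_2\end{pmatrix}\), \(B_1 = (A_1 \mid C)\), \(B_2 = (A_2 \mid C^{T})\). Its width is \(0\) if empty and \(\max\{\mathrm{width}(T_1),\mathrm{width}(T_2),\operatorname{rank}(B)\}\) otherwise. -}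

module Defs where

open import Data.Nat using (ℕ; zero; suc; _+_; _*_; _≤_; _⊔_)
open import Data.Fin using (Fin; zero; suc; splitAt)
open import Data.Fin.Permutation using (Permutation; _⟨$⟩ʳ_)
open import Data.Sum using (_⊎_; inj₁; inj₂; [_,_]′)
open import Data.Product using (Σ; _×_; _,_)
open import Data.Unit using (⊤)
open import Relation.Binary.PropositionalEquality using (_≡_)

Mat : ℕ → ℕ → Set
Mat r c = Fin r → Fin c → ℕ

sumF : ∀ {r} → (Fin r → ℕ) → ℕ
sumF {zero}  f = 0
sumF {suc r} f = f zero + sumF (λ i → f (suc i))

_·_ : ∀ {a b c} → Mat a b → Mat b c → Mat a c
(A · B) i j = sumF (λ l → A i l * B l j)

infixl 7 _·_
infixl 6 _⊕_

_⊕_ : ∀ {a b} → Mat a b → Mat a b → Mat a b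
(A ⊕ B) i j = A i j + B i j

_ᵀ : ∀ {a b} → Mat a b → Mat b a
(A ᵀ) i j = A j i

zeroM : ∀ {a b} → Mat a b
zeroM _ _ = 0

_≐_ : ∀ {a b} → Mat a b → Mat a b → Set
A ≐ B = ∀ i j → A i j ≡ B i j

_∣_ : ∀ {a b c} → Mat a b → Mat a c → Mat a (b + c)
(_∣_ {b = b} A B) i j = [ A i , B i ]′ (splitAt b j)

stack : ∀ {a b c} → Mat a c → Mat b c → Mat (a + b) c
stack {a} A B i j = [ (λ i′ → A i′ j) , (λ i′ → B i′ j) ]′ (splitAt a i)

block : ∀ {a b c d} → Mat a c → Mat a d → Mat b c → Mat b d → Mat (a + b) (c + d)
block A B C D = stack (A ∣ B) (C ∣ D)

diag : ∀ {a b c d} → Mat a c → Mat b d → Mat (a + b) (c + d)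
diag A D = block A zeroM zeroM D

-- [G] = [H]  iff  G + Gᵀ = H + Hᵀ
_≈ᴳ_ : ∀ {k} → Mat k k → Mat k k → Set
G ≈ᴳ H = (G ⊕ G ᵀ) ≐ (H ⊕ H ᵀ)

FactorsThrough : ∀ {a b} → Mat a b → ℕ → Set
FactorsThrough {a} {b} A r = Σ (Mat a r) λ X → Σ (Mat r b) λ Y → A ≐ (X · Y)

IsRank : ∀ {a b} → Mat a b → ℕ → Set
IsRank A r = FactorsThrough A r × (∀ s → FactorsThrough A s → r ≤ s)

RankLe : ∀ {a b} → Mat a b → ℕ → Set
RankLe A w = Σ ℕ λ r → IsRank A r × r ≤ w

record Grph (n m : ℕ) : Set where
  field
    k : ℕ
    G : Mat k k
    L : Mat k n
    R : Mat k m
    P : Mat m n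
    F : Mat m m
open Grph public

-- equality of morphisms: up to [G] and permutation of vertices
_≈_ : ∀ {n m} → Grph n m → Grph n m → Set
g ≈ h = Σ (Permutation (k g) (k h)) λ σ →
    (∀ i j → G g i j + G g j i ≡ G h (σ ⟨$⟩ʳ i) (σ ⟨$⟩ʳ j) + G h (σ ⟨$⟩ʳ j) (σ ⟨$⟩ʳ i))
  × (∀ i a → L g i a ≡ L h (σ ⟨$⟩ʳ i) a)
  × (∀ i a → R g i a ≡ R h (σ ⟨$⟩ʳ i) a)
  × (P g ≐ P h)
  × (F g ≐ F h)

_⨾_ : ∀ {n x m} → Grph n x → Grph x m → Grph n m
g ⨾ h = record
  { k = k g + k h
  ; G = block (G g) (R g · (L h ᵀ)) zeroM (G h ⊕ L h · F g · (L h ᵀ))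
  ; L = stack (L g) (L h · P g)
  ; R = stack (R g · (P h ᵀ)) (R h ⊕ L h · F g · (P h ᵀ) ⊕ L h · (F g ᵀ) · (P h ᵀ))
  ; P = P h · P g
  ; F = F h ⊕ P h · F g · (P h ᵀ)
  }

_⊗_ : ∀ {n m n′ m′} → Grph n m → Grph n′ m′ → Grph (n + n′) (m + m′)
g ⊗ h = record
  { k = k g + k h
  ; G = diag (G g) (G h)
  ; L = diag (L g) (L h)
  ; R = diag (R g) (R h)
  ; P = diag (P g) (P h)
  ; F = diag (F g) (F h)
  }

-- Monoidal decompositions (every morphism is atomic).

data Dec : ℕ → ℕ → Set where
  atom : ∀ {n m} → Grph n m → Dec n m
  tens : ∀ {n m n′ m′} → Dec n m → Dec n′ m′ → Dec (n + n′) (m + m′)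
  comp : ∀ {n m} (x : ℕ) → Dec n x → Dec x m → Dec n m

eval : ∀ {n m} → Dec n m → Grph n m
eval (atom g)     = g
eval (tens d e)   = eval d ⊗ eval e
eval (comp x d e) = eval d ⨾ eval e

-- weight of an atom = number of vertices; weight of object x = x
width : ∀ {n m} → Dec n m → ℕ
width (atom g)     = k g
width (tens d e)   = width d ⊔ width e
width (comp x d e) = width d ⊔ width e ⊔ x

-- Inductive rank decompositions of a graph with dangling edges (G , B),
-- G : Mat k k, B : Mat k n.  Children are nonempty (size suc _).

data IRD : (k n : ℕ) → Mat k k → Mat k n → Set where
  empty : ∀ {n} {G : Mat 0 0} {B : Mat 0 n} → IRD 0 n G B
  leaf  : ∀ {n} {G : Mat 1 1} {B : Mat 1 n} → IRD 1 n G B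
  node  : ∀ {k n} {G : Mat k k} {B : Mat k n} (k₁ k₂ : ℕ)
          (σ : Permutation (suc k₁ + suc k₂) k)
          (G₁ : Mat (suc k₁) (suc k₁)) (G₂ : Mat (suc k₂) (suc k₂))
          (C : Mat (suc k₁) (suc k₂))
          (A₁ : Mat (suc k₁) n) (A₂ : Mat (suc k₂) n) →
          (∀ i j → G (σ ⟨$⟩ʳ i) (σ ⟨$⟩ʳ j) + G (σ ⟨$⟩ʳ j) (σ ⟨$⟩ʳ i)
                   ≡ block G₁ C zeroM G₂ i j + block G₁ C zeroM G₂ j i) →
          (∀ i a → B (σ ⟨$⟩ʳ i) a ≡ stack A₁ A₂ i a) →
          IRD (suc k₁) (n + suc k₂) G₁ (A₁ ∣ C) →
          IRD (suc k₂) (n + suc k₁) G₂ (A₂ ∣ (C ᵀ)) →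
          IRD k n G B

IRDWidthLe : ∀ {k n G B} → IRD k n G B → ℕ → Set
IRDWidthLe empty w = ⊤
IRDWidthLe {B = B} leaf w = RankLe B w
IRDWidthLe {B = B} (node _ _ _ _ _ _ _ _ _ _ T₁ T₂) w =
  RankLe B w × IRDWidthLe T₁ w × IRDWidthLe T₂ w

{-# OPTIONS --safe #-}
-- The theorem is proved for a stronger invariant, by induction on the monoidal
-- decomposition d of g.  Place g in a context that joins its left boundary points i and j
-- by Φ i j wires and left point i to right point j by Ψ i j wires: this turns the graph
-- into G + L Φ Lᵀ and the right boundary into R + L Ψ.  If rank L, rank (R + L Ψ) and the
-- width of d are at most W, then for every B whose columns lie in the span of the columns
-- of L and R + L Ψ the graph (G + L Φ Lᵀ, B) has an inductive rank decomposition of width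
-- at most 2W.  An atom has at most W vertices, so any decomposition of it will do.  At a
-- node of d split the vertices into those of the two factors.  Each half, with the edges
-- crossing to the other half as extra dangling edges, is again of this form for its
-- factor in a suitably updated context (for g₁ ; g₂ the context of g₂ absorbs F and P of
-- g₁), while the root boundary B has rank at most rank L + rank (R + L Ψ) ≤ 2W.  The
-- theorem is the case Φ = Ψ = 0, B = (L ∣ R).
module Submission where

open import Defs
open import Data.Nat using (ℕ; zero; suc; _+_; _*_; _≤_; _<_; _⊔_; _⊓_; z≤n; s≤s)
open import Data.Nat.Properties
open import Data.Fin using (Fin; zero; suc; splitAt; toℕ; fromℕ<; _↑ˡ_; _↑ʳ_)
open import Data.Fin.Properties
  using (toℕ-injective; toℕ-cast; toℕ-↑ˡ; splitAt-↑ˡ; splitAt-↑ʳ; splitAt⁻¹-↑ˡ; splitAt⁻¹-↑ʳ; toℕ-fromℕ<; all?; any?)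
open import Data.Fin.Permutation using (Permutation; _⟨$⟩ʳ_; _⟨$⟩ˡ_; inverseʳ; _∘ₚ_)
import Data.Fin.Permutation as Perm
open import Data.Vec using (Vec; []; _∷_; lookup; tabulate)
open import Data.Vec.Properties using (lookup∘tabulate)
open import Data.Sum using (_⊎_; inj₁; inj₂; [_,_]′)
open import Data.Product using (Σ; _×_; _,_; proj₁; proj₂)
open import Data.Unit using (tt)
open import Data.Empty using (⊥-elim)
open import Relation.Nullary using (¬_; yes; no)
import Relation.Nullary as Nullary
open import Level using (0ℓ)
open import Relation.Binary.Bundles using (Setoid)
open import Relation.Binary.PropositionalEquality
import Relation.Binary.Reasoning.Setoid as SetoidReasoning
open import Algebra.Properties.CommutativeSemigroup +-commutativeSemigroup using () renaming (interchange to +-interchange)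
open import Algebra.Properties.Semiring.Sum +-*-semiring using (sum; ∑-distrib-+; ∑-comm; *-distribˡ-sum; sum-replicate-zero)

-- Finite sums

sumF≡sum : ∀ {r} (f : Fin r → ℕ) → sumF f ≡ sum f
sumF≡sum {zero}  f = refl
sumF≡sum {suc r} f = cong (f zero +_) (sumF≡sum (λ i → f (suc i)))

sumF-cong : ∀ {r} {f g : Fin r → ℕ} → (∀ i → f i ≡ g i) → sumF f ≡ sumF g
sumF-cong {zero}  e = refl
sumF-cong {suc r} e = cong₂ _+_ (e zero) (sumF-cong (λ i → e (suc i)))

sumF-zero : ∀ r → sumF {r} (λ _ → 0) ≡ 0
sumF-zero r = trans (sumF≡sum {r} _) (sum-replicate-zero r)

sumF-distrib-+ : ∀ {r} (f g : Fin r → ℕ) → sumF (λ i → f i + g i) ≡ sumF f + sumF g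
sumF-distrib-+ f g = begin
  sumF (λ i → f i + g i) ≡⟨ sumF≡sum (λ i → f i + g i) ⟩
  sum (λ i → f i + g i)  ≡⟨ ∑-distrib-+ f g ⟩
  sum f + sum g          ≡⟨ sym (cong₂ _+_ (sumF≡sum f) (sumF≡sum g)) ⟩
  sumF f + sumF g        ∎
  where open ≡-Reasoning

*-distribˡ-sumF : ∀ {r} x (f : Fin r → ℕ) → x * sumF f ≡ sumF (λ i → x * f i)
*-distribˡ-sumF x f = begin
  x * sumF f             ≡⟨ cong (x *_) (sumF≡sum f) ⟩
  x * sum f              ≡⟨ *-distribˡ-sum x f ⟩
  sum (λ i → x * f i)    ≡⟨ sumF≡sum (λ i → x * f i) ⟨
  sumF (λ i → x * f i)   ∎
  where open ≡-Reasoning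

*-distribʳ-sumF : ∀ {r} x (f : Fin r → ℕ) → sumF f * x ≡ sumF (λ i → f i * x)
*-distribʳ-sumF x f = begin
  sumF f * x             ≡⟨ *-comm (sumF f) x ⟩
  x * sumF f             ≡⟨ *-distribˡ-sumF x f ⟩
  sumF (λ i → x * f i)   ≡⟨ sumF-cong (λ i → *-comm x (f i)) ⟩
  sumF (λ i → f i * x)   ∎
  where open ≡-Reasoning

sumF-comm : ∀ {r s} (f : Fin r → Fin s → ℕ) →
            sumF (λ i → sumF (f i)) ≡ sumF (λ j → sumF (λ i → f i j))
sumF-comm f = begin
  sumF (λ i → sumF (f i))            ≡⟨ double-sum f ⟩
  sum (λ i → sum (f i))              ≡⟨ ∑-comm f ⟩
  sum (λ j → sum (λ i → f i j))      ≡⟨ double-sum (λ j i → f i j) ⟨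
  sumF (λ j → sumF (λ i → f i j))    ∎
  where
  open ≡-Reasoning
  double-sum : ∀ {a b} (h : Fin a → Fin b → ℕ) → sumF (λ i → sumF (h i)) ≡ sum (λ i → sum (h i))
  double-sum h = trans (sumF-cong (λ i → sumF≡sum (h i))) (sumF≡sum (λ i → sum (h i)))

sumF-++ : ∀ a {b} (f : Fin (a + b) → ℕ) →
          sumF f ≡ sumF (λ i → f (i ↑ˡ b)) + sumF (λ j → f (a ↑ʳ j))
sumF-++ zero    f = refl
sumF-++ (suc a) f = trans (cong (f zero +_) (sumF-++ a (λ i → f (suc i))))
                          (sym (+-assoc (f zero) _ _))

term≤sumF : ∀ {r} (f : Fin r → ℕ) i → f i ≤ sumF f
term≤sumF f zero    = m≤m+n _ _
term≤sumF f (suc i) = ≤-trans (term≤sumF (λ j → f (suc j)) i) (m≤n+m _ _)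

-- Matrix algebra

-- _≐_ has Agda's default fixity, which binds tighter than _·_ and _⊕_.
infix 4 _≋_
_≋_ : ∀ {a b} → Mat a b → Mat a b → Set
_≋_ = _≐_

≋-refl : ∀ {a b} {A : Mat a b} → A ≋ A
≋-refl i j = refl

≋-sym : ∀ {a b} {A B : Mat a b} → A ≋ B → B ≋ A
≋-sym e i j = sym (e i j)

≋-trans : ∀ {a b} {A B C : Mat a b} → A ≋ B → B ≋ C → A ≋ C
≋-trans e f i j = trans (e i j) (f i j)

≋-setoid : ℕ → ℕ → Setoid 0ℓ 0ℓ
≋-setoid a b = record
  { Carrier = Mat a b
  ; _≈_ = _≋_
  ; isEquivalence = record { refl = ≋-refl ; sym = ≋-sym ; trans = ≋-trans }
  }

module ≋-Reasoning {a b : ℕ} = SetoidReasoning (≋-setoid a b)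

·-cong : ∀ {a b c} {A A′ : Mat a b} {B B′ : Mat b c} → A ≋ A′ → B ≋ B′ → A · B ≋ A′ · B′
·-cong e f i j = sumF-cong (λ l → cong₂ _*_ (e i l) (f l j))

·-congˡ : ∀ {a b c} (A : Mat a b) {B B′ : Mat b c} → B ≋ B′ → A · B ≋ A · B′
·-congˡ A = ·-cong (≋-refl {A = A})

·-congʳ : ∀ {a b c} {A A′ : Mat a b} (B : Mat b c) → A ≋ A′ → A · B ≋ A′ · B
·-congʳ B e = ·-cong e (≋-refl {A = B})

⊕-cong : ∀ {a b} {A A′ B B′ : Mat a b} → A ≋ A′ → B ≋ B′ → A ⊕ B ≋ A′ ⊕ B′
⊕-cong e f i j = cong₂ _+_ (e i j) (f i j)

⊕-congˡ : ∀ {a b} (A : Mat a b) {B B′ : Mat a b} → B ≋ B′ → A ⊕ B ≋ A ⊕ B′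
⊕-congˡ A = ⊕-cong (≋-refl {A = A})

⊕-congʳ : ∀ {a b} {A A′ : Mat a b} (B : Mat a b) → A ≋ A′ → A ⊕ B ≋ A′ ⊕ B
⊕-congʳ B e = ⊕-cong e (≋-refl {A = B})

ᵀ-cong : ∀ {a b} {A A′ : Mat a b} → A ≋ A′ → A ᵀ ≋ A′ ᵀ
ᵀ-cong e i j = e j i

⊕-identityʳ : ∀ {a b} (A : Mat a b) → A ⊕ zeroM ≋ A
⊕-identityʳ A i j = +-identityʳ (A i j)

⊕-assoc : ∀ {a b} (A B C : Mat a b) → A ⊕ B ⊕ C ≋ A ⊕ (B ⊕ C)
⊕-assoc A B C i j = +-assoc (A i j) (B i j) (C i j)

⊕-interchange : ∀ {a b} (A B C D : Mat a b) → (A ⊕ B) ⊕ (C ⊕ D) ≋ (A ⊕ C) ⊕ (B ⊕ D)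
⊕-interchange A B C D i j = +-interchange (A i j) (B i j) (C i j) (D i j)

·-zeroˡ : ∀ {a b c} (B : Mat b c) → zeroM {a} · B ≋ zeroM
·-zeroˡ {b = b} B i j = sumF-zero b

·-zeroʳ : ∀ {a b c} (A : Mat a b) → A · zeroM {b} {c} ≋ zeroM
·-zeroʳ {b = b} A i j = trans (sumF-cong (λ l → *-zeroʳ (A i l))) (sumF-zero b)

·-distribˡ-⊕ : ∀ {a b c} (A : Mat a b) (B C : Mat b c) → A · (B ⊕ C) ≋ A · B ⊕ A · C
·-distribˡ-⊕ A B C i j = trans (sumF-cong (λ l → *-distribˡ-+ (A i l) (B l j) (C l j)))
                                (sumF-distrib-+ (λ l → A i l * B l j) (λ l → A i l * C l j))

·-distribʳ-⊕ : ∀ {a b c} (A B : Mat a b) (C : Mat b c) → (A ⊕ B) · C ≋ A · C ⊕ B · C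
·-distribʳ-⊕ A B C i j = trans (sumF-cong (λ l → *-distribʳ-+ (C l j) (A i l) (B i l)))
                                (sumF-distrib-+ (λ l → A i l * C l j) (λ l → B i l * C l j))

·-assoc : ∀ {a b c d} (A : Mat a b) (B : Mat b c) (C : Mat c d) → A · B · C ≋ A · (B · C)
·-assoc A B C i j = begin
  sumF (λ l → sumF (λ p → A i p * B p l) * C l j)
    ≡⟨ sumF-cong (λ l → *-distribʳ-sumF (C l j) (λ p → A i p * B p l)) ⟩
  sumF (λ l → sumF (λ p → A i p * B p l * C l j))
    ≡⟨ sumF-comm (λ l p → A i p * B p l * C l j) ⟩
  sumF (λ p → sumF (λ l → A i p * B p l * C l j))
    ≡⟨ sumF-cong (λ p → sumF-cong (λ l → *-assoc (A i p) (B p l) (C l j))) ⟩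
  sumF (λ p → sumF (λ l → A i p * (B p l * C l j)))
    ≡⟨ sumF-cong (λ p → *-distribˡ-sumF (A i p) (λ l → B p l * C l j)) ⟨
  sumF (λ p → A i p * sumF (λ l → B p l * C l j)) ∎
  where open ≡-Reasoning

ᵀ-· : ∀ {a b c} (A : Mat a b) (B : Mat b c) → (A · B) ᵀ ≋ B ᵀ · A ᵀ
ᵀ-· A B i j = sumF-cong (λ l → *-comm (A j l) (B l i))

·-sandwich : ∀ {a b c} (A : Mat a b) (B : Mat b c) (Φ : Mat c c) →
             (A · B) · Φ · (A · B) ᵀ ≋ A · (B · Φ · B ᵀ) · A ᵀ
·-sandwich A B Φ = begin
  A · B · Φ · (A · B) ᵀ         ≈⟨ ·-congˡ (A · B · Φ) (ᵀ-· A B) ⟩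
  A · B · Φ · (B ᵀ · A ᵀ)       ≈⟨ ·-assoc (A · B · Φ) (B ᵀ) (A ᵀ) ⟨
  A · B · Φ · B ᵀ · A ᵀ         ≈⟨ ·-congʳ (A ᵀ) (·-congʳ (B ᵀ) (·-assoc A B Φ)) ⟩
  A · (B · Φ) · B ᵀ · A ᵀ       ≈⟨ ·-congʳ (A ᵀ) (·-assoc A (B · Φ) (B ᵀ)) ⟩
  A · (B · Φ · B ᵀ) · A ᵀ       ∎
  where open ≋-Reasoning

ᵀ-sandwich : ∀ {a b c d} (A : Mat a c) (Φ : Mat c d) (B : Mat b d) → (A · Φ · B ᵀ) ᵀ ≋ B · Φ ᵀ · A ᵀ
ᵀ-sandwich A Φ B = begin
  (A · Φ · B ᵀ) ᵀ      ≈⟨ ᵀ-· (A · Φ) (B ᵀ) ⟩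
  B · (A · Φ) ᵀ        ≈⟨ ·-congˡ B (ᵀ-· A Φ) ⟩
  B · (Φ ᵀ · A ᵀ)      ≈⟨ ·-assoc B (Φ ᵀ) (A ᵀ) ⟨
  B · Φ ᵀ · A ᵀ        ∎
  where open ≋-Reasoning

sandwich-distrib-⊕ : ∀ {a b b′ c} (A : Mat a b) (Φ Φ′ : Mat b b′) (B : Mat b′ c) →
                     A · Φ · B ⊕ A · Φ′ · B ≋ A · (Φ ⊕ Φ′) · B
sandwich-distrib-⊕ A Φ Φ′ B =
  ≋-trans (≋-sym (·-distribʳ-⊕ (A · Φ) (A · Φ′) B)) (·-congʳ B (≋-sym (·-distribˡ-⊕ A Φ Φ′)))

δ : ∀ {n} → Mat n n
δ zero    zero    = 1
δ zero    (suc j) = 0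
δ (suc i) zero    = 0
δ (suc i) (suc j) = δ i j

·-identityˡ : ∀ {a b} (A : Mat a b) → δ · A ≋ A
·-identityˡ {suc a} A zero j =
  trans (cong (A zero j + 0 +_) (sumF-zero a)) (trans (+-identityʳ _) (+-identityʳ _))
·-identityˡ A (suc i) j = ·-identityˡ (λ l → A (suc l)) i j

·-identityʳ : ∀ {a b} (A : Mat a b) → A · δ ≋ A
·-identityʳ A i j = trans (sumF-cong (λ l → trans (*-comm (A i l) (δ l j)) (cong (_* A i l) (δ-sym l j))))
                          (·-identityˡ (A ᵀ) j i)
  where
  δ-sym : ∀ {n} (i j : Fin n) → δ i j ≡ δ j i
  δ-sym zero    zero    = refl
  δ-sym zero    (suc j) = refl
  δ-sym (suc i) zero    = refl
  δ-sym (suc i) (suc j) = δ-sym i j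

-- Block matrices

data SplitView (a b : ℕ) : Fin (a + b) → Set where
  lhs : ∀ i → SplitView a b (i ↑ˡ b)
  rhs : ∀ j → SplitView a b (a ↑ʳ j)

splitView : ∀ a b (i : Fin (a + b)) → SplitView a b i
splitView a b i with splitAt a i in eq
... | inj₁ i′ = subst (SplitView a b) (splitAt⁻¹-↑ˡ eq) (lhs i′)
... | inj₂ j′ = subst (SplitView a b) (splitAt⁻¹-↑ʳ eq) (rhs j′)

top : ∀ {a b c} → Mat (a + b) c → Mat a c
top {b = b} A i j = A (i ↑ˡ b) j

bottom : ∀ {a b c} → Mat (a + b) c → Mat b c
bottom {a} A i j = A (a ↑ʳ i) j

left : ∀ {a b c} → Mat a (b + c) → Mat a b
left {c = c} A i j = A i (j ↑ˡ c)

right : ∀ {a b c} → Mat a (b + c) → Mat a c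
right {b = b} A i j = A i (b ↑ʳ j)

top-stack : ∀ {a b c} (A : Mat a c) (B : Mat b c) → top {a} {b} (stack A B) ≋ A
top-stack {a} {b} A B i j rewrite splitAt-↑ˡ a i b = refl

bottom-stack : ∀ {a b c} (A : Mat a c) (B : Mat b c) → bottom {a} {b} (stack A B) ≋ B
bottom-stack {a} {b} A B i j rewrite splitAt-↑ʳ a b i = refl

∣-↑ˡ : ∀ {a b c} (A : Mat a b) (B : Mat a c) i j → (A ∣ B) i (j ↑ˡ c) ≡ A i j
∣-↑ˡ {b = b} {c} A B i j rewrite splitAt-↑ˡ b j c = refl

∣-↑ʳ : ∀ {a b c} (A : Mat a b) (B : Mat a c) i j → (A ∣ B) i (b ↑ʳ j) ≡ B i j
∣-↑ʳ {b = b} {c} A B i j rewrite splitAt-↑ʳ b c j = refl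

left-≋-∣ : ∀ {a b c} {X : Mat a (b + c)} {A : Mat a b} {B : Mat a c} → X ≋ (A ∣ B) → left {b = b} {c} X ≋ A
left-≋-∣ {c = c} {A = A} {B} X≋ i j = trans (X≋ i (j ↑ˡ c)) (∣-↑ˡ A B i j)

right-≋-∣ : ∀ {a b c} {X : Mat a (b + c)} {A : Mat a b} {B : Mat a c} → X ≋ (A ∣ B) → right {b = b} {c} X ≋ B
right-≋-∣ {b = b} {A = A} {B} X≋ i j = trans (X≋ i (b ↑ʳ j)) (∣-↑ʳ A B i j)

left-∣-right : ∀ {a b c} (X : Mat a (b + c)) → X ≋ (left {b = b} {c} X ∣ right {b = b} {c} X)
left-∣-right {b = b} {c} X i j with splitView b c j
... | lhs j′ = sym (∣-↑ˡ (left {b = b} {c} X) (right {b = b} {c} X) i j′)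
... | rhs j′ = sym (∣-↑ʳ (left {b = b} {c} X) (right {b = b} {c} X) i j′)

block-↑ˡ↑ˡ : ∀ {a b c d} (A : Mat a c) (B : Mat a d) (C : Mat b c) (D : Mat b d) i j →
             block A B C D (i ↑ˡ b) (j ↑ˡ d) ≡ A i j
block-↑ˡ↑ˡ {a} {b} A B C D i j rewrite splitAt-↑ˡ a i b = ∣-↑ˡ A B i j

block-↑ˡ↑ʳ : ∀ {a b c d} (A : Mat a c) (B : Mat a d) (C : Mat b c) (D : Mat b d) i j →
             block A B C D (i ↑ˡ b) (c ↑ʳ j) ≡ B i j
block-↑ˡ↑ʳ {a} {b} A B C D i j rewrite splitAt-↑ˡ a i b = ∣-↑ʳ A B i j

block-↑ʳ↑ˡ : ∀ {a b c d} (A : Mat a c) (B : Mat a d) (C : Mat b c) (D : Mat b d) i j →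
             block A B C D (a ↑ʳ i) (j ↑ˡ d) ≡ C i j
block-↑ʳ↑ˡ {a} {b} A B C D i j rewrite splitAt-↑ʳ a b i = ∣-↑ˡ C D i j

block-↑ʳ↑ʳ : ∀ {a b c d} (A : Mat a c) (B : Mat a d) (C : Mat b c) (D : Mat b d) i j →
             block A B C D (a ↑ʳ i) (c ↑ʳ j) ≡ D i j
block-↑ʳ↑ʳ {a} {b} A B C D i j rewrite splitAt-↑ʳ a b i = ∣-↑ʳ C D i j

·-split : ∀ {a} b {c d} (A : Mat a (b + c)) (X : Mat (b + c) d) →
          A · X ≋ left {b = b} {c} A · top {b} {c} X ⊕ right {b = b} {c} A · bottom {b} {c} X
·-split b A X i j = sumF-++ b _

∣-· : ∀ {a b c d} (A : Mat a b) (B : Mat a c) (X : Mat (b + c) d) →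
      (A ∣ B) · X ≋ A · top {b} {c} X ⊕ B · bottom {b} {c} X
∣-· {b = b} {c} A B X i j = trans (·-split b (A ∣ B) X i j)
  (cong₂ _+_ (sumF-cong (λ l → cong (_* X (l ↑ˡ c) j) (∣-↑ˡ A B i l)))
             (sumF-cong (λ l → cong (_* X (b ↑ʳ l) j) (∣-↑ʳ A B i l))))

·-∣ : ∀ {a b c d} (X : Mat a b) (A : Mat b c) (B : Mat b d) → X · (A ∣ B) ≋ ((X · A) ∣ (X · B))
·-∣ {c = c} X A B i j with splitAt c j
... | inj₁ _ = refl
... | inj₂ _ = refl

⊕-∣ : ∀ {a b c} (A A′ : Mat a b) (B B′ : Mat a c) → (A ∣ B) ⊕ (A′ ∣ B′) ≋ ((A ⊕ A′) ∣ (B ⊕ B′))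
⊕-∣ {b = b} A A′ B B′ i j with splitAt b j
... | inj₁ _ = refl
... | inj₂ _ = refl

∣-cong : ∀ {a b c} {A A′ : Mat a b} {B B′ : Mat a c} → A ≋ A′ → B ≋ B′ → (A ∣ B) ≋ (A′ ∣ B′)
∣-cong {b = b} e f i j with splitAt b j
... | inj₁ j′ = e i j′
... | inj₂ j′ = f i j′

∣0-· : ∀ {a b c d} (A : Mat a b) (X : Mat (b + c) d) → (A ∣ zeroM {a} {c}) · X ≋ A · top {b} {c} X
∣0-· {b = b} {c} A X = ≋-trans (∣-· A zeroM X)
  (≋-trans (⊕-congˡ (A · top {b} {c} X) (·-zeroˡ (bottom {b} {c} X))) (⊕-identityʳ (A · top {b} {c} X)))

0∣-· : ∀ {a b c d} (A : Mat a c) (X : Mat (b + c) d) → (zeroM {a} {b} ∣ A) · X ≋ A · bottom {b} {c} X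
0∣-· {b = b} {c} A X = ≋-trans (∣-· zeroM A X) (⊕-congʳ (A · bottom {b} {c} X) (·-zeroˡ (top {b} {c} X)))

·-∣0ᵀ : ∀ {a b c d} (Y : Mat d (b + c)) (A : Mat a b) → Y · (A ∣ zeroM {a} {c}) ᵀ ≋ left {b = b} {c} Y · A ᵀ
·-∣0ᵀ {a} {b} {c} Y A = begin
  Y · (A ∣ zeroM) ᵀ                               ≈⟨ ·-split b Y ((A ∣ zeroM) ᵀ) ⟩
  Yˡ · top {b} {c} ((A ∣ zeroM) ᵀ) ⊕ Yʳ · bottom {b} {c} ((A ∣ zeroM) ᵀ)
    ≈⟨ ⊕-cong (·-congˡ Yˡ (λ i j → ∣-↑ˡ A (zeroM {b = c}) j i))
              (·-congˡ Yʳ (λ i j → ∣-↑ʳ A (zeroM {b = c}) j i)) ⟩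
  Yˡ · A ᵀ ⊕ Yʳ · zeroM                            ≈⟨ ⊕-congˡ (Yˡ · A ᵀ) (·-zeroʳ Yʳ) ⟩
  Yˡ · A ᵀ ⊕ zeroM                                 ≈⟨ ⊕-identityʳ (Yˡ · A ᵀ) ⟩
  Yˡ · A ᵀ                                         ∎
  where
  open ≋-Reasoning
  Yˡ = left {b = b} {c} Y
  Yʳ = right {b = b} {c} Y

·-0∣ᵀ : ∀ {a b c d} (Y : Mat d (b + c)) (A : Mat a c) → Y · (zeroM {a} {b} ∣ A) ᵀ ≋ right {b = b} {c} Y · A ᵀ
·-0∣ᵀ {a} {b} {c} Y A = begin
  Y · (zeroM ∣ A) ᵀ                               ≈⟨ ·-split b Y ((zeroM ∣ A) ᵀ) ⟩
  Yˡ · top {b} {c} ((zeroM ∣ A) ᵀ) ⊕ Yʳ · bottom {b} {c} ((zeroM ∣ A) ᵀ)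
    ≈⟨ ⊕-cong (·-congˡ Yˡ (λ i j → ∣-↑ˡ (zeroM {b = b}) A j i))
              (·-congˡ Yʳ (λ i j → ∣-↑ʳ (zeroM {b = b}) A j i)) ⟩
  Yˡ · zeroM ⊕ Yʳ · A ᵀ                            ≈⟨ ⊕-congʳ (Yʳ · A ᵀ) (·-zeroʳ Yˡ) ⟩
  Yʳ · A ᵀ                                         ∎
  where
  open ≋-Reasoning
  Yˡ = left {b = b} {c} Y
  Yʳ = right {b = b} {c} Y

-- Factorisations and rank

FactorsThrough-reindex : ∀ {a b a′ b′ r} {A : Mat a b} {A′ : Mat a′ b′}
                         (f : Fin a′ → Fin a) (h : Fin b′ → Fin b) →
                         (∀ i j → A′ i j ≡ A (f i) (h j)) → FactorsThrough A r → FactorsThrough A′ r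
FactorsThrough-reindex f h e (X , Y , A≋XY) =
  (λ i → X (f i)) , (λ l j → Y l (h j)) , λ i j → trans (e i j) (A≋XY (f i) (h j))

FactorsThrough-cong : ∀ {a b r} {A A′ : Mat a b} → A′ ≋ A → FactorsThrough A r → FactorsThrough A′ r
FactorsThrough-cong = FactorsThrough-reindex (λ i → i) (λ j → j)

FactorsThrough-top : ∀ {a₁ a₂ b r} {A : Mat (a₁ + a₂) b} →
                     FactorsThrough A r → FactorsThrough (top {a₁} {a₂} A) r
FactorsThrough-top {a₂ = a₂} = FactorsThrough-reindex (_↑ˡ a₂) (λ j → j) (λ i j → refl)

FactorsThrough-bottom : ∀ {a₁ a₂ b r} {A : Mat (a₁ + a₂) b} →
                        FactorsThrough A r → FactorsThrough (bottom {a₁} {a₂} A) r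
FactorsThrough-bottom {a₁} = FactorsThrough-reindex (a₁ ↑ʳ_) (λ j → j) (λ i j → refl)

FactorsThrough-left : ∀ {a b₁ b₂ r} {A : Mat a (b₁ + b₂)} →
                      FactorsThrough A r → FactorsThrough (left {b = b₁} {b₂} A) r
FactorsThrough-left {b₂ = b₂} = FactorsThrough-reindex (λ i → i) (_↑ˡ b₂) (λ i j → refl)

FactorsThrough-right : ∀ {a b₁ b₂ r} {A : Mat a (b₁ + b₂)} →
                       FactorsThrough A r → FactorsThrough (right {b = b₁} {b₂} A) r
FactorsThrough-right {b₁ = b₁} = FactorsThrough-reindex (λ i → i) (b₁ ↑ʳ_) (λ i j → refl)

factorsThrough-rows : ∀ {a b} (A : Mat a b) → FactorsThrough A a
factorsThrough-rows A = δ , A , ≋-sym (·-identityˡ A)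

factorsThrough-cols : ∀ {a b} (A : Mat a b) → FactorsThrough A b
factorsThrough-cols A = A , δ , ≋-sym (·-identityʳ A)

-- Over ℕ every entry of a factorisation A ≋ X · Y can be clamped at the sum of the entries
-- of A, so whether A factors through r is decided by a finite search.
entrySum : ∀ {a b} → Mat a b → ℕ
entrySum A = sumF (λ i → sumF (A i))

entry≤entrySum : ∀ {a b} (A : Mat a b) i j → A i j ≤ entrySum A
entry≤entrySum A i j = ≤-trans (term≤sumF (A i) j) (term≤sumF (λ i → sumF (A i)) i)

*-clamp : ∀ x y N → x * y ≤ N → (x ⊓ N) * (y ⊓ N) ≡ x * y
*-clamp zero    y       N _  = refl
*-clamp (suc x) zero    N _  = trans (*-zeroʳ (suc x ⊓ N)) (sym (*-zeroʳ x))
*-clamp (suc x) (suc y) N le =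
  cong₂ _*_ (m≤n⇒m⊓n≡m (≤-trans (m≤m*n (suc x) (suc y)) le))
            (m≤n⇒m⊓n≡m (≤-trans (m≤n*m (suc y) (suc x)) le))

BoundedMat : ℕ → ℕ → ℕ → Set
BoundedMat N a b = Vec (Vec (Fin (suc N)) b) a

toMat : ∀ {N a b} → BoundedMat N a b → Mat a b
toMat X i j = toℕ (lookup (lookup X i) j)

clamp : ∀ {a b} N → Mat a b → BoundedMat N a b
clamp N X = tabulate (λ i → tabulate (λ j → fromℕ< (s≤s (m⊓n≤n (X i j) N))))

toMat-clamp : ∀ {a b} N (X : Mat a b) i j → toMat (clamp N X) i j ≡ X i j ⊓ N
toMat-clamp N X i j = begin
  toℕ (lookup (lookup (clamp N X) i) j)
    ≡⟨ cong (λ v → toℕ (lookup v j)) (lookup∘tabulate _ i) ⟩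
  toℕ (lookup (tabulate (λ j → fromℕ< (s≤s (m⊓n≤n (X i j) N)))) j)
    ≡⟨ cong toℕ (lookup∘tabulate _ j) ⟩
  toℕ (fromℕ< (s≤s (m⊓n≤n (X i j) N)))
    ≡⟨ toℕ-fromℕ< _ ⟩
  X i j ⊓ N ∎
  where open ≡-Reasoning

FactorsThroughBounded : ∀ {a b} → Mat a b → ℕ → Set
FactorsThroughBounded {a} {b} A r =
  Σ (BoundedMat (entrySum A) a r) λ X → Σ (BoundedMat (entrySum A) r b) λ Y → A ≋ toMat X · toMat Y

factorsThroughBounded : ∀ {a b r} (A : Mat a b) → FactorsThrough A r → FactorsThroughBounded A r
factorsThroughBounded A (X , Y , A≋XY) =
  clamp N X , clamp N Y , λ i j → trans (A≋XY i j) (sumF-cong (λ l → sym (clamped-term i j l)))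
  where
  N = entrySum A
  term≤N : ∀ i j l → X i l * Y l j ≤ N
  term≤N i j l = ≤-trans (term≤sumF (λ l → X i l * Y l j) l)
                         (≤-trans (≤-reflexive (sym (A≋XY i j))) (entry≤entrySum A i j))
  clamped-term : ∀ i j l → toMat (clamp N X) i l * toMat (clamp N Y) l j ≡ X i l * Y l j
  clamped-term i j l = trans (cong₂ _*_ (toMat-clamp N X i l) (toMat-clamp N Y l j))
                             (*-clamp (X i l) (Y l j) N (term≤N i j l))

Searchable : Set → Set₁
Searchable A = ∀ (P : A → Set) → (∀ x → Nullary.Dec (P x)) → Nullary.Dec (Σ A P)

searchable-Fin : ∀ n → Searchable (Fin n)
searchable-Fin n P P? = any? P?

searchable-Vec : ∀ {A} → Searchable A → ∀ k → Searchable (Vec A k)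
searchable-Vec search zero P P? with P? []
... | yes p = yes ([] , p)
... | no ¬p = no (λ { ([] , p) → ¬p p })
searchable-Vec search (suc k) P P?
  with search (λ x → Σ _ (λ xs → P (x ∷ xs)))
              (λ x → searchable-Vec search k (λ xs → P (x ∷ xs)) (λ xs → P? (x ∷ xs)))
... | yes (x , xs , p) = yes (x ∷ xs , p)
... | no ¬p = no (λ { (x ∷ xs , p) → ¬p (x , xs , p) })

searchable-BoundedMat : ∀ N a b → Searchable (BoundedMat N a b)
searchable-BoundedMat N a b = searchable-Vec (searchable-Vec (searchable-Fin (suc N)) b) a

≋-dec : ∀ {a b} (A B : Mat a b) → Nullary.Dec (A ≋ B)
≋-dec A B = all? (λ i → all? (λ j → A i j ≟ B i j))

factorsThrough? : ∀ {a b} (A : Mat a b) r → Nullary.Dec (FactorsThrough A r)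
factorsThrough? {a} {b} A r
  with searchable-BoundedMat _ a r (λ X → Σ _ λ Y → A ≋ toMat X · toMat Y)
         (λ X → searchable-BoundedMat _ r b (λ Y → A ≋ toMat X · toMat Y) (λ Y → ≋-dec A (toMat X · toMat Y)))
... | yes (X , Y , A≋XY) = yes (toMat X , toMat Y , A≋XY)
... | no ¬bounded        = no (λ f → ¬bounded (factorsThroughBounded A f))

Least : (ℕ → Set) → ℕ → Set
Least P r = P r × (∀ s → P s → r ≤ s)

module _ {P : ℕ → Set} (P? : ∀ s → Nullary.Dec (P s)) where

  leastBelow : ∀ n → Σ ℕ (Least P) ⊎ (∀ t → t < n → ¬ P t)
  leastBelow zero = inj₂ (λ t ())
  leastBelow (suc n) with leastBelow n
  ... | inj₁ r = inj₁ r
  ... | inj₂ none with P? n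
  ...   | yes pn = inj₁ (n , pn , λ t pt → ≮⇒≥ (λ t<n → none t t<n pt))
  ...   | no ¬pn = inj₂ (λ t t<1+n pt →
                     [ (λ t<n → none t t<n pt) , (λ { refl → ¬pn pt }) ]′ (m<1+n⇒m<n∨m≡n t<1+n))

  least : ∀ s → P s → Σ ℕ (Least P)
  least s p with leastBelow (suc s)
  ... | inj₁ r    = r
  ... | inj₂ none = ⊥-elim (none s ≤-refl p)

factorsThrough⇒RankLe : ∀ {a b r w} (A : Mat a b) → FactorsThrough A r → r ≤ w → RankLe A w
factorsThrough⇒RankLe {r = r} A f r≤w with least (factorsThrough? A) r f
... | ρ , isRank = ρ , isRank , ≤-trans (proj₂ isRank r f) r≤w

-- Column spans

record InSpan {k p q c} (L : Mat k p) (R : Mat k q) (B : Mat k c) : Set where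
  constructor span
  field
    coeffˡ : Mat p c
    coeffʳ : Mat q c
    B≋    : B ≋ L · coeffˡ ⊕ R · coeffʳ

module _ {k p q} {L : Mat k p} {R : Mat k q} where

  InSpan-cong : ∀ {c} {B B′ : Mat k c} → B ≋ B′ → InSpan L R B′ → InSpan L R B
  InSpan-cong B≋B′ (span M M′ B′≋) = span M M′ (≋-trans B≋B′ B′≋)

  InSpan-ˡ : ∀ {c} (M : Mat p c) → InSpan L R (L · M)
  InSpan-ˡ M = span M zeroM (≋-sym (≋-trans (⊕-congˡ (L · M) (·-zeroʳ R)) (⊕-identityʳ (L · M))))

  InSpan-ʳ : ∀ {c} (M : Mat q c) → InSpan L R (R · M)
  InSpan-ʳ M = span zeroM M (≋-sym (⊕-congʳ (R · M) (·-zeroʳ L)))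

  InSpan-L : InSpan L R L
  InSpan-L = InSpan-cong (≋-sym (·-identityʳ L)) (InSpan-ˡ δ)

  InSpan-R : InSpan L R R
  InSpan-R = InSpan-cong (≋-sym (·-identityʳ R)) (InSpan-ʳ δ)

  InSpan-zero : ∀ {c} → InSpan L R (zeroM {k} {c})
  InSpan-zero = InSpan-cong (≋-sym (·-zeroʳ L)) (InSpan-ˡ zeroM)

  InSpan-⊕ : ∀ {c} {B E : Mat k c} → InSpan L R B → InSpan L R E → InSpan L R (B ⊕ E)
  InSpan-⊕ {B = B} {E} (span M M′ B≋) (span N N′ E≋) = span (M ⊕ N) (M′ ⊕ N′) (begin
    B ⊕ E                                    ≈⟨ ⊕-cong B≋ E≋ ⟩
    (L · M ⊕ R · M′) ⊕ (L · N ⊕ R · N′)      ≈⟨ ⊕-interchange (L · M) (R · M′) (L · N) (R · N′) ⟩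
    (L · M ⊕ L · N) ⊕ (R · M′ ⊕ R · N′)      ≈⟨ ⊕-cong (·-distribˡ-⊕ L M N) (·-distribˡ-⊕ R M′ N′) ⟨
    L · (M ⊕ N) ⊕ R · (M′ ⊕ N′)              ∎)
    where open ≋-Reasoning

  InSpan-·ʳ : ∀ {c d} {B : Mat k c} → InSpan L R B → (X : Mat c d) → InSpan L R (B · X)
  InSpan-·ʳ {B = B} (span M M′ B≋) X = span (M · X) (M′ · X) (begin
    B · X                          ≈⟨ ·-congʳ X B≋ ⟩
    (L · M ⊕ R · M′) · X           ≈⟨ ·-distribʳ-⊕ (L · M) (R · M′) X ⟩
    L · M · X ⊕ R · M′ · X         ≈⟨ ⊕-cong (·-assoc L M X) (·-assoc R M′ X) ⟩
    L · (M · X) ⊕ R · (M′ · X)     ∎)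
    where open ≋-Reasoning

  InSpan-∣ : ∀ {c c′} {B : Mat k c} {E : Mat k c′} →
             InSpan L R B → InSpan L R E → InSpan L R (B ∣ E)
  InSpan-∣ {B = B} {E} (span M M′ B≋) (span N N′ E≋) = span (M ∣ N) (M′ ∣ N′) (begin
    (B ∣ E)                                       ≈⟨ ∣-cong B≋ E≋ ⟩
    ((L · M ⊕ R · M′) ∣ (L · N ⊕ R · N′))         ≈⟨ ⊕-∣ (L · M) (R · M′) (L · N) (R · N′) ⟨
    ((L · M) ∣ (L · N)) ⊕ ((R · M′) ∣ (R · N′))   ≈⟨ ⊕-cong (·-∣ L M N) (·-∣ R M′ N′) ⟨
    L · (M ∣ N) ⊕ R · (M′ ∣ N′)                   ∎)
    where open ≋-Reasoning

  InSpan-trans : ∀ {p′ q′ c} {L′ : Mat k p′} {R′ : Mat k q′} {B : Mat k c} →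
                 InSpan L R L′ → InSpan L R R′ → InSpan L′ R′ B → InSpan L R B
  InSpan-trans L′∈ R′∈ (span M M′ B≋) =
    InSpan-cong B≋ (InSpan-⊕ (InSpan-·ʳ L′∈ M) (InSpan-·ʳ R′∈ M′))

InSpan-top : ∀ {k₁ k₂ p q c} {L : Mat (k₁ + k₂) p} {R : Mat (k₁ + k₂) q} {B : Mat (k₁ + k₂) c} →
             InSpan L R B → InSpan (top {k₁} {k₂} L) (top {k₁} {k₂} R) (top {k₁} {k₂} B)
InSpan-top {k₂ = k₂} (span M M′ B≋) = span M M′ (λ i → B≋ (i ↑ˡ k₂))

InSpan-bottom : ∀ {k₁ k₂ p q c} {L : Mat (k₁ + k₂) p} {R : Mat (k₁ + k₂) q} {B : Mat (k₁ + k₂) c} →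
                InSpan L R B → InSpan (bottom {k₁} {k₂} L) (bottom {k₁} {k₂} R) (bottom {k₁} {k₂} B)
InSpan-bottom {k₁} (span M M′ B≋) = span M M′ (λ i → B≋ (k₁ ↑ʳ i))

InSpan⇒FactorsThrough : ∀ {k p q c a b} {L : Mat k p} {R : Mat k q} {B : Mat k c} →
                        FactorsThrough L a → FactorsThrough R b → InSpan L R B → FactorsThrough B (a + b)
InSpan⇒FactorsThrough {a = a} {b} {L} {R} {B} (X , Y , L≋XY) (X′ , Y′ , R≋XY′) (span M M′ B≋) =
  (X ∣ X′) , stack (Y · M) (Y′ · M′) , (begin
  B                                      ≈⟨ B≋ ⟩
  L · M ⊕ R · M′                         ≈⟨ ⊕-cong (·-congʳ M L≋XY) (·-congʳ M′ R≋XY′) ⟩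
  X · Y · M ⊕ X′ · Y′ · M′               ≈⟨ ⊕-cong (·-assoc X Y M) (·-assoc X′ Y′ M′) ⟩
  X · (Y · M) ⊕ X′ · (Y′ · M′)           ≈⟨ ⊕-cong (·-congˡ X (top-stack (Y · M) (Y′ · M′)))
                                                   (·-congˡ X′ (bottom-stack (Y · M) (Y′ · M′))) ⟨
  X · top {a} {b} S ⊕ X′ · bottom {a} S  ≈⟨ ∣-· X X′ S ⟨
  (X ∣ X′) · S                           ∎)
  where
  open ≋-Reasoning
  S = stack (Y · M) (Y′ · M′)

InSpan⇒RankLe : ∀ {k p q c a b W} {L : Mat k p} {R : Mat k q} →
                FactorsThrough L a → FactorsThrough R b → a ≤ W → b ≤ W →
                (B : Mat k c) → InSpan L R B → RankLe B (2 * W)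
InSpan⇒RankLe {W = W} fL fR a≤W b≤W B B∈ =
  factorsThrough⇒RankLe B (InSpan⇒FactorsThrough fL fR B∈)
                          (+-mono-≤ a≤W (≤-trans b≤W (≤-reflexive (sym (+-identityʳ W)))))

RankLe-permuteRows : ∀ {k k′ c w} {B : Mat k c} {B′ : Mat k′ c} (τ : Permutation k k′) →
                     (∀ i a → B′ (τ ⟨$⟩ʳ i) a ≡ B i a) → RankLe B w → RankLe B′ w
RankLe-permuteRows {B = B} {B′} τ B′τ≡B (r , (f , minimal) , r≤w) =
  r , (FactorsThrough-reindex (τ ⟨$⟩ˡ_) (λ a → a) B′≡Bτ⁻¹ f ,
       λ s f′ → minimal s (FactorsThrough-reindex (τ ⟨$⟩ʳ_) (λ a → a) (λ i a → sym (B′τ≡B i a)) f′)) ,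
  r≤w
  where
  B′≡Bτ⁻¹ : ∀ i a → B′ i a ≡ B (τ ⟨$⟩ˡ i) a
  B′≡Bτ⁻¹ i a = trans (cong (λ z → B′ z a) (sym (inverseʳ τ))) (B′τ≡B (τ ⟨$⟩ˡ i) a)

-- Inductive rank decompositions

≈ᴳ-cong : ∀ {k} {G H : Mat k k} → G ≋ H → ∀ i j → G i j + G j i ≡ H i j + H j i
≈ᴳ-cong e i j = cong₂ _+_ (e i j) (e j i)

IRDWithin : ∀ {k c} → ℕ → Mat k k → Mat k c → Set
IRDWithin {k} {c} w G B = Σ (IRD k c G B) (λ T → IRDWidthLe T w)

IRD-permute : ∀ {k k′ c w} {G : Mat k k} {B : Mat k c} {G′ : Mat k′ k′} {B′ : Mat k′ c}
  (τ : Permutation k k′) →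
  (∀ i j → G′ (τ ⟨$⟩ʳ i) (τ ⟨$⟩ʳ j) + G′ (τ ⟨$⟩ʳ j) (τ ⟨$⟩ʳ i) ≡ G i j + G j i) →
  (∀ i a → B′ (τ ⟨$⟩ʳ i) a ≡ B i a) →
  IRDWithin w G B → IRDWithin w G′ B′
IRD-permute {k′ = zero}        τ _ _ (empty , _) = empty , tt
IRD-permute {k′ = suc _}       τ _ _ (empty , _) = ⊥-elim (Perm.refute (λ ()) τ)
IRD-permute {k′ = zero}        τ _ _ (leaf , _)  = ⊥-elim (Perm.refute (λ ()) τ)
IRD-permute {k′ = suc zero}    τ _ B′τ≡B (leaf , rk) = leaf , RankLe-permuteRows τ B′τ≡B rk
IRD-permute {k′ = suc (suc _)} τ _ _ (leaf , _)  = ⊥-elim (Perm.refute (λ ()) τ)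
IRD-permute τ G′τ≡G B′τ≡B (node k₁ k₂ σ G₁ G₂ C A₁ A₂ Gσ≡ Bσ≡ T₁ T₂ , rk , w₁ , w₂) =
  node k₁ k₂ (σ ∘ₚ τ) G₁ G₂ C A₁ A₂
    (λ i j → trans (G′τ≡G (σ ⟨$⟩ʳ i) (σ ⟨$⟩ʳ j)) (Gσ≡ i j))
    (λ i a → trans (B′τ≡B (σ ⟨$⟩ʳ i) a) (Bσ≡ i a)) T₁ T₂ ,
  RankLe-permuteRows τ B′τ≡B rk , w₁ , w₂

IRDWithin-cong : ∀ {k c w} {G G′ : Mat k k} {B : Mat k c} → G ≋ G′ → IRDWithin w G′ B → IRDWithin w G B
IRDWithin-cong G≋G′ = IRD-permute Perm.id (≈ᴳ-cong G≋G′) (λ i a → refl)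

topLeft : ∀ {k₁ k₂} → Mat (k₁ + k₂) (k₁ + k₂) → Mat k₁ k₁
topLeft {k₁} {k₂} G i j = G (i ↑ˡ k₂) (j ↑ˡ k₂)

bottomRight : ∀ {k₁ k₂} → Mat (k₁ + k₂) (k₁ + k₂) → Mat k₂ k₂
bottomRight {k₁} G i j = G (k₁ ↑ʳ i) (k₁ ↑ʳ j)

crossing : ∀ {k₁ k₂} → Mat (k₁ + k₂) (k₁ + k₂) → Mat k₁ k₂
crossing {k₁} {k₂} G i j = G (i ↑ˡ k₂) (k₁ ↑ʳ j) + G (k₁ ↑ʳ j) (i ↑ˡ k₂)

topLeft-block : ∀ {a b} (A : Mat a a) (B : Mat a b) (C : Mat b a) (D : Mat b b) →
                topLeft {a} {b} (block A B C D) ≋ A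
topLeft-block A B C D = block-↑ˡ↑ˡ A B C D

bottomRight-block : ∀ {a b} (A : Mat a a) (B : Mat a b) (C : Mat b a) (D : Mat b b) →
                    bottomRight {a} {b} (block A B C D) ≋ D
bottomRight-block A B C D = block-↑ʳ↑ʳ A B C D

crossing-block : ∀ {a b} (A : Mat a a) (B : Mat a b) (C : Mat b a) (D : Mat b b) →
                 crossing {a} {b} (block A B C D) ≋ B ⊕ C ᵀ
crossing-block A B C D i j = cong₂ _+_ (block-↑ˡ↑ʳ A B C D i j) (block-↑ʳ↑ˡ A B C D j i)

crossing-⊕-sandwich : ∀ {k₁ k₂ n} (G : Mat (k₁ + k₂) (k₁ + k₂)) (L : Mat (k₁ + k₂) n) (Φ : Mat n n) →
  crossing {k₁} {k₂} (G ⊕ L · Φ · L ᵀ)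
  ≋ crossing {k₁} {k₂} G ⊕ top {k₁} {k₂} L · (Φ ⊕ Φ ᵀ) · bottom {k₁} {k₂} L ᵀ
crossing-⊕-sandwich {k₁} {k₂} G L Φ i j = begin
  (G u v + S u v) + (G v u + S v u)
    ≡⟨ +-interchange (G u v) (S u v) (G v u) (S v u) ⟩
  crossing {k₁} G i j + (S u v + S v u)
    ≡⟨ cong (λ t → crossing {k₁} G i j + (S u v + t)) (ᵀ-sandwich L₂ Φ L₁ i j) ⟩
  crossing {k₁} G i j + (L₁ · Φ · L₂ ᵀ ⊕ L₁ · Φ ᵀ · L₂ ᵀ) i j
    ≡⟨ cong (crossing {k₁} G i j +_) (sandwich-distrib-⊕ L₁ Φ (Φ ᵀ) (L₂ ᵀ) i j) ⟩
  crossing {k₁} G i j + (L₁ · (Φ ⊕ Φ ᵀ) · L₂ ᵀ) i j ∎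
  where
  open ≡-Reasoning
  S = L · Φ · L ᵀ
  L₁ = top {k₁} {k₂} L
  L₂ = bottom {k₁} {k₂} L
  u = i ↑ˡ k₂
  v = k₁ ↑ʳ j

-- All edges between the two halves are recorded in the upper right block.
module _ {k₁ k₂} (G : Mat (k₁ + k₂) (k₁ + k₂)) where
  private
    G₁ = topLeft {k₁} {k₂} G
    G₂ = bottomRight {k₁} {k₂} G
    C  = crossing {k₁} {k₂} G

  ≈ᴳ-block : ∀ i j → G i j + G j i ≡ block G₁ C zeroM G₂ i j + block G₁ C zeroM G₂ j i
  ≈ᴳ-block i j with splitView k₁ k₂ i | splitView k₁ k₂ j
  ... | lhs x | lhs y rewrite block-↑ˡ↑ˡ G₁ C zeroM G₂ x y | block-↑ˡ↑ˡ G₁ C zeroM G₂ y x = refl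
  ... | lhs x | rhs y rewrite block-↑ˡ↑ʳ G₁ C zeroM G₂ x y | block-↑ʳ↑ˡ G₁ C zeroM G₂ y x = sym (+-identityʳ _)
  ... | rhs x | lhs y rewrite block-↑ʳ↑ˡ G₁ C zeroM G₂ x y | block-↑ˡ↑ʳ G₁ C zeroM G₂ y x =
    +-comm (G (k₁ ↑ʳ x) (y ↑ˡ k₂)) _
  ... | rhs x | rhs y rewrite block-↑ʳ↑ʳ G₁ C zeroM G₂ x y | block-↑ʳ↑ʳ G₁ C zeroM G₂ y x = refl

stack-top-bottom : ∀ {k₁ k₂ c} (B : Mat (k₁ + k₂) c) i a →
                   B i a ≡ stack (top {k₁} {k₂} B) (bottom {k₁} {k₂} B) i a
stack-top-bottom {k₁} {k₂} B i a with splitView k₁ k₂ i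
... | lhs x = sym (top-stack (top {k₁} {k₂} B) (bottom {k₁} {k₂} B) x a)
... | rhs y = sym (bottom-stack (top {k₁} {k₂} B) (bottom {k₁} {k₂} B) y a)

module _ {k₁ k₂ c} (G : Mat (suc k₁ + suc k₂) (suc k₁ + suc k₂)) (B : Mat (suc k₁ + suc k₂) c) where
  private
    G₁ = topLeft {suc k₁} {suc k₂} G
    G₂ = bottomRight {suc k₁} {suc k₂} G
    C  = crossing {suc k₁} {suc k₂} G
    A₁ = top {suc k₁} {suc k₂} B
    A₂ = bottom {suc k₁} {suc k₂} B

  bisect : ∀ {w} → RankLe B w → IRDWithin w G₁ (A₁ ∣ C) → IRDWithin w G₂ (A₂ ∣ (C ᵀ)) → IRDWithin w G B
  bisect rk (T₁ , w₁) (T₂ , w₂) =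
    node k₁ k₂ Perm.id G₁ G₂ C A₁ A₂ (≈ᴳ-block {suc k₁} G) (stack-top-bottom {suc k₁} B) T₁ T₂ ,
    rk , w₁ , w₂

IRD-small : ∀ {k c w} (G : Mat k k) (B : Mat k c) → k ≤ w → IRDWithin w G B
IRD-small {zero}        G B k≤w = empty , tt
IRD-small {suc zero}    G B k≤w = leaf , factorsThrough⇒RankLe B (factorsThrough-rows B) k≤w
IRD-small {suc (suc k)} G B k≤w =
  bisect G B (factorsThrough⇒RankLe B (factorsThrough-rows B) k≤w)
    (IRD-small (topLeft {1} G) (top {1} B ∣ crossing {1} G) (≤-trans (s≤s z≤n) k≤w))
    (IRD-small (bottomRight {1} G) (bottom {1} B ∣ (crossing {1} G ᵀ)) (≤-trans (n≤1+n _) k≤w))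

record SpanSplitting {k₁ k₂ p q p₁ q₁ p₂ q₂ : ℕ}
    (H : Mat (k₁ + k₂) (k₁ + k₂)) (L : Mat (k₁ + k₂) p) (R : Mat (k₁ + k₂) q)
    (H₁ : Mat k₁ k₁) (L₁ : Mat k₁ p₁) (R₁ : Mat k₁ q₁)
    (H₂ : Mat k₂ k₂) (L₂ : Mat k₂ p₂) (R₂ : Mat k₂ q₂) : Set where
  field
    topLeft≋     : topLeft {k₁} {k₂} H ≋ H₁
    bottomRight≋ : bottomRight {k₁} {k₂} H ≋ H₂
    top-InSpan      : ∀ {c} (B : Mat (k₁ + k₂) c) → InSpan L R B → InSpan L₁ R₁ (top {k₁} {k₂} B)
    bottom-InSpan   : ∀ {c} (B : Mat (k₁ + k₂) c) → InSpan L R B → InSpan L₂ R₂ (bottom {k₁} {k₂} B)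
    crossing-InSpan  : InSpan L₁ R₁ (crossing {k₁} {k₂} H)
    crossingᵀ-InSpan : InSpan L₂ R₂ (crossing {k₁} {k₂} H ᵀ)

↑ˡ-zero-perm : ∀ k → Σ (Permutation k (k + 0)) λ τ → ∀ i → τ ⟨$⟩ʳ i ≡ i ↑ˡ 0
↑ˡ-zero-perm k = Perm.cast-id (sym (+-identityʳ k)) ,
                 λ i → toℕ-injective (trans (toℕ-cast _ i) (sym (toℕ-↑ˡ i 0)))

IRD-split : ∀ {k₁ k₂ p q p₁ q₁ p₂ q₂ w}
  {H : Mat (k₁ + k₂) (k₁ + k₂)} {L : Mat (k₁ + k₂) p} {R : Mat (k₁ + k₂) q}
  {H₁ : Mat k₁ k₁} {L₁ : Mat k₁ p₁} {R₁ : Mat k₁ q₁}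
  {H₂ : Mat k₂ k₂} {L₂ : Mat k₂ p₂} {R₂ : Mat k₂ q₂} →
  SpanSplitting H L R H₁ L₁ R₁ H₂ L₂ R₂ →
  (∀ {c} (B : Mat k₁ c) → InSpan L₁ R₁ B → IRDWithin w H₁ B) →
  (∀ {c} (B : Mat k₂ c) → InSpan L₂ R₂ B → IRDWithin w H₂ B) →
  (∀ {c} (B : Mat (k₁ + k₂) c) → InSpan L R B → RankLe B w) →
  ∀ {c} (B : Mat (k₁ + k₂) c) → InSpan L R B → IRDWithin w H B
IRD-split {k₁} {zero} {H = H} S decompose₁ _ _ B B∈ =
  IRD-permute τ (λ i j → trans (cong₂ (λ x y → H x y + H y x) (τ≡ i) (τ≡ j)) (≈ᴳ-cong topLeft≋ i j))
                (λ i a → cong (λ x → B x a) (τ≡ i))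
                (decompose₁ (top {k₁} {zero} B) (top-InSpan B B∈))
  where
  open SpanSplitting S
  τ = proj₁ (↑ˡ-zero-perm k₁)
  τ≡ = proj₂ (↑ˡ-zero-perm k₁)
IRD-split {zero} {suc k₂} S _ decompose₂ _ B B∈ =
  IRDWithin-cong bottomRight≋ (decompose₂ B (bottom-InSpan B B∈))
  where open SpanSplitting S
IRD-split {suc k₁} {suc k₂} {H = H} S decompose₁ decompose₂ rank B B∈ =
  bisect H B (rank B B∈)
    (IRDWithin-cong topLeft≋ (decompose₁ _ (InSpan-∣ (top-InSpan B B∈) crossing-InSpan)))
    (IRDWithin-cong bottomRight≋ (decompose₂ _ (InSpan-∣ (bottom-InSpan B B∈) crossingᵀ-InSpan)))
  where open SpanSplitting S

-- Graphs in a context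

Gctx : ∀ {n m} (g : Grph n m) → Mat n n → Mat (k g) (k g)
Gctx g Φ = G g ⊕ L g · Φ · L g ᵀ

Rctx : ∀ {n m} (g : Grph n m) → Mat n m → Mat (k g) m
Rctx g Ψ = R g ⊕ L g · Ψ

Gctx-zero : ∀ {n m} (g : Grph n m) → Gctx g zeroM ≋ G g
Gctx-zero g = ≋-trans (⊕-congˡ (G g) (≋-trans (·-congʳ (L g ᵀ) (·-zeroʳ (L g))) (·-zeroˡ (L g ᵀ))))
                      (⊕-identityʳ (G g))

Rctx-zero : ∀ {n m} (g : Grph n m) → Rctx g zeroM ≋ R g
Rctx-zero g = ≋-trans (⊕-congˡ (R g) (·-zeroʳ (L g))) (⊕-identityʳ (R g))

module Composite {n x m} (g₁ : Grph n x) (g₂ : Grph x m) (Φ : Mat n n) (Ψ : Mat n m) where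

  private
    k₁ = k g₁
    k₂ = k g₂
    g = g₁ ⨾ g₂
    H = Gctx g Φ
    L₁ = L g₁
    L₂ = L g₂
    R₁ = R g₁

  Φ₂ : Mat x x
  Φ₂ = F g₁ ⊕ P g₁ · Φ · P g₁ ᵀ

  Ψ₂ : Mat x m
  Ψ₂ = F g₁ · P g₂ ᵀ ⊕ F g₁ ᵀ · P g₂ ᵀ ⊕ P g₁ · Ψ

  top-L : top {k₁} {k₂} (L g) ≋ L₁
  top-L = top-stack L₁ (L₂ · P g₁)

  bottom-L : bottom {k₁} {k₂} (L g) ≋ L₂ · P g₁
  bottom-L = bottom-stack L₁ (L₂ · P g₁)

  top-Rctx : top {k₁} {k₂} (Rctx g Ψ) ≋ R₁ · P g₂ ᵀ ⊕ L₁ · Ψ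
  top-Rctx = ⊕-cong (top-stack (R₁ · P g₂ ᵀ) _) (·-congʳ Ψ top-L)

  bottom-Rctx : bottom {k₁} {k₂} (Rctx g Ψ) ≋ Rctx g₂ Ψ₂
  bottom-Rctx = begin
    bottom {k₁} (R g) ⊕ bottom {k₁} (L g) · Ψ
      ≈⟨ ⊕-cong (bottom-stack (R₁ · P g₂ ᵀ) _) (·-congʳ Ψ bottom-L) ⟩
    R g₂ ⊕ L₂ · F g₁ · P g₂ ᵀ ⊕ L₂ · F g₁ ᵀ · P g₂ ᵀ ⊕ L₂ · P g₁ · Ψ
      ≈⟨ ⊕-cong (⊕-cong (⊕-congˡ (R g₂) (·-assoc L₂ (F g₁) (P g₂ ᵀ)))
                        (·-assoc L₂ (F g₁ ᵀ) (P g₂ ᵀ)))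
                (·-assoc L₂ (P g₁) Ψ) ⟩
    R g₂ ⊕ L₂ · (F g₁ · P g₂ ᵀ) ⊕ L₂ · (F g₁ ᵀ · P g₂ ᵀ) ⊕ L₂ · (P g₁ · Ψ)
      ≈⟨ ⊕-congʳ (L₂ · (P g₁ · Ψ)) (⊕-assoc (R g₂) _ _) ⟩
    R g₂ ⊕ (L₂ · (F g₁ · P g₂ ᵀ) ⊕ L₂ · (F g₁ ᵀ · P g₂ ᵀ)) ⊕ L₂ · (P g₁ · Ψ)
      ≈⟨ ⊕-assoc (R g₂) _ _ ⟩
    R g₂ ⊕ (L₂ · (F g₁ · P g₂ ᵀ) ⊕ L₂ · (F g₁ ᵀ · P g₂ ᵀ) ⊕ L₂ · (P g₁ · Ψ))
      ≈⟨ ⊕-congˡ (R g₂) (⊕-congʳ (L₂ · (P g₁ · Ψ)) (·-distribˡ-⊕ L₂ _ _)) ⟨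
    R g₂ ⊕ (L₂ · (F g₁ · P g₂ ᵀ ⊕ F g₁ ᵀ · P g₂ ᵀ) ⊕ L₂ · (P g₁ · Ψ))
      ≈⟨ ⊕-congˡ (R g₂) (·-distribˡ-⊕ L₂ _ _) ⟨
    Rctx g₂ Ψ₂ ∎
    where open ≋-Reasoning

  topLeft-Gctx : topLeft {k₁} {k₂} H ≋ Gctx g₁ Φ
  topLeft-Gctx = ⊕-cong (topLeft-block (G g₁) _ zeroM _) (·-cong (·-congʳ Φ top-L) (ᵀ-cong top-L))

  bottomRight-Gctx : bottomRight {k₁} {k₂} H ≋ Gctx g₂ Φ₂
  bottomRight-Gctx = begin
    bottomRight {k₁} (G g) ⊕ bottom {k₁} (L g) · Φ · bottom {k₁} (L g) ᵀ
      ≈⟨ ⊕-cong (bottomRight-block (G g₁) _ zeroM _) (·-cong (·-congʳ Φ bottom-L) (ᵀ-cong bottom-L)) ⟩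
    G g₂ ⊕ L₂ · F g₁ · L₂ ᵀ ⊕ L₂ · P g₁ · Φ · (L₂ · P g₁) ᵀ
      ≈⟨ ⊕-congˡ (G g₂ ⊕ L₂ · F g₁ · L₂ ᵀ) (·-sandwich L₂ (P g₁) Φ) ⟩
    G g₂ ⊕ L₂ · F g₁ · L₂ ᵀ ⊕ L₂ · (P g₁ · Φ · P g₁ ᵀ) · L₂ ᵀ
      ≈⟨ ⊕-assoc (G g₂) _ _ ⟩
    G g₂ ⊕ (L₂ · F g₁ · L₂ ᵀ ⊕ L₂ · (P g₁ · Φ · P g₁ ᵀ) · L₂ ᵀ)
      ≈⟨ ⊕-congˡ (G g₂) (sandwich-distrib-⊕ L₂ (F g₁) _ (L₂ ᵀ)) ⟩
    Gctx g₂ Φ₂ ∎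
    where open ≋-Reasoning

  crossing-Gctx : crossing {k₁} {k₂} H ≋ R₁ · L₂ ᵀ ⊕ L₁ · (Φ ⊕ Φ ᵀ) · (L₂ · P g₁) ᵀ
  crossing-Gctx = begin
    crossing {k₁} H
      ≈⟨ crossing-⊕-sandwich {k₁} (G g) (L g) Φ ⟩
    crossing {k₁} (G g) ⊕ top {k₁} (L g) · (Φ ⊕ Φ ᵀ) · bottom {k₁} (L g) ᵀ
      ≈⟨ ⊕-cong (crossing-block (G g₁) (R₁ · L₂ ᵀ) zeroM _)
                (·-cong (·-congʳ (Φ ⊕ Φ ᵀ) top-L) (ᵀ-cong bottom-L)) ⟩
    R₁ · L₂ ᵀ ⊕ zeroM ⊕ L₁ · (Φ ⊕ Φ ᵀ) · (L₂ · P g₁) ᵀ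
      ≈⟨ ⊕-congʳ (L₁ · (Φ ⊕ Φ ᵀ) · (L₂ · P g₁) ᵀ) (⊕-identityʳ (R₁ · L₂ ᵀ)) ⟩
    R₁ · L₂ ᵀ ⊕ L₁ · (Φ ⊕ Φ ᵀ) · (L₂ · P g₁) ᵀ ∎
    where open ≋-Reasoning

  L₁-factors : ∀ {r} → FactorsThrough (L g) r → FactorsThrough L₁ r
  L₁-factors f = FactorsThrough-cong (≋-sym top-L) (FactorsThrough-top {k₁} {k₂} f)

  Rctx₂-factors : ∀ {r} → FactorsThrough (Rctx g Ψ) r → FactorsThrough (Rctx g₂ Ψ₂) r
  Rctx₂-factors f = FactorsThrough-cong (≋-sym bottom-Rctx) (FactorsThrough-bottom {k₁} {k₂} f)

  R₁-InSpan : InSpan L₁ (Rctx g₁ zeroM) R₁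
  R₁-InSpan = InSpan-cong (≋-sym (Rctx-zero g₁)) InSpan-R

  splitting : SpanSplitting H (L g) (Rctx g Ψ) (Gctx g₁ Φ) L₁ (Rctx g₁ zeroM) (Gctx g₂ Φ₂) L₂ (Rctx g₂ Ψ₂)
  splitting = record
    { topLeft≋     = topLeft-Gctx
    ; bottomRight≋ = bottomRight-Gctx
    ; top-InSpan   = λ B B∈ → InSpan-trans
        (InSpan-cong top-L InSpan-L)
        (InSpan-cong top-Rctx (InSpan-⊕ (InSpan-·ʳ R₁-InSpan (P g₂ ᵀ)) (InSpan-ˡ Ψ)))
        (InSpan-top B∈)
    ; bottom-InSpan = λ B B∈ → InSpan-trans
        (InSpan-cong bottom-L (InSpan-ˡ (P g₁)))
        (InSpan-cong bottom-Rctx InSpan-R)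
        (InSpan-bottom B∈)
    ; crossing-InSpan = InSpan-cong crossing-Gctx
        (InSpan-⊕ (InSpan-·ʳ R₁-InSpan (L₂ ᵀ)) (InSpan-cong (·-assoc L₁ (Φ ⊕ Φ ᵀ) _) (InSpan-ˡ _)))
    ; crossingᵀ-InSpan = InSpan-cong (λ i j → crossing-Gctx j i)
        (InSpan-⊕ (InSpan-cong (ᵀ-· R₁ (L₂ ᵀ)) (InSpan-ˡ (R₁ ᵀ)))
                  (InSpan-cong (≋-trans (ᵀ-sandwich L₁ (Φ ⊕ Φ ᵀ) (L₂ · P g₁))
                                        (≋-trans (·-congʳ (L₁ ᵀ) (·-assoc L₂ (P g₁) _)) (·-assoc L₂ _ (L₁ ᵀ))))
                               (InSpan-ˡ _)))
    }

module Tensor {n m n′ m′} (g₁ : Grph n m) (g₂ : Grph n′ m′)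
              (Φ : Mat (n + n′) (n + n′)) (Ψ : Mat (n + n′) (m + m′)) where

  private
    k₁ = k g₁
    k₂ = k g₂
    g = g₁ ⊗ g₂
    H = Gctx g Φ
    L₁ = L g₁
    L₂ = L g₂
    Φ× = right {b = n} {n′} (top {n} {n′} (Φ ⊕ Φ ᵀ))
    Ψ₁₂ = right {b = m} {m′} (top {n} {n′} Ψ)
    Ψ₂₁ = left {b = m} {m′} (bottom {n} {n′} Ψ)

  Φ₁ : Mat n n
  Φ₁ = left {b = n} {n′} (top {n} {n′} Φ)

  Φ₂ : Mat n′ n′
  Φ₂ = right {b = n} {n′} (bottom {n} {n′} Φ)

  Ψ₁ : Mat n m
  Ψ₁ = left {b = m} {m′} (top {n} {n′} Ψ)

  Ψ₂ : Mat n′ m′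
  Ψ₂ = right {b = m} {m′} (bottom {n} {n′} Ψ)

  top-L : top {k₁} {k₂} (L g) ≋ (L₁ ∣ zeroM)
  top-L = top-stack (L₁ ∣ zeroM) (zeroM ∣ L₂)

  bottom-L : bottom {k₁} {k₂} (L g) ≋ (zeroM ∣ L₂)
  bottom-L = bottom-stack (L₁ ∣ zeroM) (zeroM ∣ L₂)

  top-Rctx : top {k₁} {k₂} (Rctx g Ψ) ≋ (Rctx g₁ Ψ₁ ∣ (L₁ · Ψ₁₂))
  top-Rctx = begin
    top {k₁} (R g) ⊕ top {k₁} (L g) · Ψ
      ≈⟨ ⊕-cong (top-stack (R g₁ ∣ zeroM) (zeroM ∣ R g₂)) (≋-trans (·-congʳ Ψ top-L) (∣0-· L₁ Ψ)) ⟩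
    (R g₁ ∣ zeroM) ⊕ L₁ · top {n} Ψ
      ≈⟨ ⊕-congˡ (R g₁ ∣ zeroM)
                 (≋-trans (·-congˡ L₁ (left-∣-right {b = m} {m′} (top {n} Ψ))) (·-∣ L₁ Ψ₁ Ψ₁₂)) ⟩
    (R g₁ ∣ zeroM) ⊕ ((L₁ · Ψ₁) ∣ (L₁ · Ψ₁₂))
      ≈⟨ ⊕-∣ (R g₁) (L₁ · Ψ₁) zeroM (L₁ · Ψ₁₂) ⟩
    (Rctx g₁ Ψ₁ ∣ (L₁ · Ψ₁₂)) ∎
    where open ≋-Reasoning

  bottom-Rctx : bottom {k₁} {k₂} (Rctx g Ψ) ≋ ((L₂ · Ψ₂₁) ∣ Rctx g₂ Ψ₂)
  bottom-Rctx = begin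
    bottom {k₁} (R g) ⊕ bottom {k₁} (L g) · Ψ
      ≈⟨ ⊕-cong (bottom-stack (R g₁ ∣ zeroM) (zeroM ∣ R g₂))
                (≋-trans (·-congʳ Ψ bottom-L) (0∣-· L₂ Ψ)) ⟩
    (zeroM ∣ R g₂) ⊕ L₂ · bottom {n} Ψ
      ≈⟨ ⊕-congˡ (zeroM ∣ R g₂)
                 (≋-trans (·-congˡ L₂ (left-∣-right {b = m} {m′} (bottom {n} Ψ))) (·-∣ L₂ Ψ₂₁ Ψ₂)) ⟩
    (zeroM ∣ R g₂) ⊕ ((L₂ · Ψ₂₁) ∣ (L₂ · Ψ₂))
      ≈⟨ ⊕-∣ zeroM (L₂ · Ψ₂₁) (R g₂) (L₂ · Ψ₂) ⟩
    ((L₂ · Ψ₂₁) ∣ Rctx g₂ Ψ₂) ∎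
    where open ≋-Reasoning

  topLeft-Gctx : topLeft {k₁} {k₂} H ≋ Gctx g₁ Φ₁
  topLeft-Gctx = ⊕-cong (topLeft-block (G g₁) zeroM zeroM (G g₂))
    (≋-trans (·-cong (≋-trans (·-congʳ Φ top-L) (∣0-· L₁ Φ)) (ᵀ-cong top-L))
             (·-∣0ᵀ (L₁ · top {n} Φ) L₁))

  bottomRight-Gctx : bottomRight {k₁} {k₂} H ≋ Gctx g₂ Φ₂
  bottomRight-Gctx = ⊕-cong (bottomRight-block (G g₁) zeroM zeroM (G g₂))
    (≋-trans (·-cong (≋-trans (·-congʳ Φ bottom-L) (0∣-· L₂ Φ)) (ᵀ-cong bottom-L))
             (·-0∣ᵀ (L₂ · bottom {n} Φ) L₂))

  crossing-Gctx : crossing {k₁} {k₂} H ≋ L₁ · Φ× · L₂ ᵀ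
  crossing-Gctx = ≋-trans (crossing-⊕-sandwich {k₁} (G g) (L g) Φ)
    (⊕-cong (crossing-block (G g₁) zeroM zeroM (G g₂))
            (≋-trans (·-cong (≋-trans (·-congʳ (Φ ⊕ Φ ᵀ) top-L) (∣0-· L₁ (Φ ⊕ Φ ᵀ))) (ᵀ-cong bottom-L))
                     (·-0∣ᵀ (L₁ · top {n} (Φ ⊕ Φ ᵀ)) L₂)))

  L₁-factors : ∀ {r} → FactorsThrough (L g) r → FactorsThrough L₁ r
  L₁-factors f = FactorsThrough-cong (≋-sym (left-≋-∣ top-L))
                   (FactorsThrough-left {b₁ = n} (FactorsThrough-top {k₁} {k₂} f))

  L₂-factors : ∀ {r} → FactorsThrough (L g) r → FactorsThrough L₂ r
  L₂-factors f = FactorsThrough-cong (≋-sym (right-≋-∣ bottom-L))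
                   (FactorsThrough-right {b₁ = n} (FactorsThrough-bottom {k₁} {k₂} f))

  Rctx₁-factors : ∀ {r} → FactorsThrough (Rctx g Ψ) r → FactorsThrough (Rctx g₁ Ψ₁) r
  Rctx₁-factors f = FactorsThrough-cong (≋-sym (left-≋-∣ top-Rctx))
                      (FactorsThrough-left {b₁ = m} (FactorsThrough-top {k₁} {k₂} f))

  Rctx₂-factors : ∀ {r} → FactorsThrough (Rctx g Ψ) r → FactorsThrough (Rctx g₂ Ψ₂) r
  Rctx₂-factors f = FactorsThrough-cong (≋-sym (right-≋-∣ bottom-Rctx))
                      (FactorsThrough-right {b₁ = m} (FactorsThrough-bottom {k₁} {k₂} f))

  splitting : SpanSplitting H (L g) (Rctx g Ψ) (Gctx g₁ Φ₁) L₁ (Rctx g₁ Ψ₁) (Gctx g₂ Φ₂) L₂ (Rctx g₂ Ψ₂)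
  splitting = record
    { topLeft≋     = topLeft-Gctx
    ; bottomRight≋ = bottomRight-Gctx
    ; top-InSpan   = λ B B∈ → InSpan-trans
        (InSpan-cong top-L (InSpan-∣ InSpan-L InSpan-zero))
        (InSpan-cong top-Rctx (InSpan-∣ InSpan-R (InSpan-ˡ Ψ₁₂)))
        (InSpan-top B∈)
    ; bottom-InSpan = λ B B∈ → InSpan-trans
        (InSpan-cong bottom-L (InSpan-∣ InSpan-zero InSpan-L))
        (InSpan-cong bottom-Rctx (InSpan-∣ (InSpan-ˡ Ψ₂₁) InSpan-R))
        (InSpan-bottom B∈)
    ; crossing-InSpan = InSpan-cong (≋-trans crossing-Gctx (·-assoc L₁ Φ× (L₂ ᵀ))) (InSpan-ˡ _)
    ; crossingᵀ-InSpan = InSpan-cong (≋-trans (λ i j → crossing-Gctx j i)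
                                       (≋-trans (ᵀ-sandwich L₁ Φ× L₂) (·-assoc L₂ (Φ× ᵀ) (L₁ ᵀ))))
                                     (InSpan-ˡ _)
    }

decomposition⇒IRD : ∀ {n m W a b} (d : Dec n m) → width d ≤ W → a ≤ W → b ≤ W →
  (Φ : Mat n n) (Ψ : Mat n m) → FactorsThrough (L (eval d)) a → FactorsThrough (Rctx (eval d) Ψ) b →
  ∀ {c} (B : Mat (k (eval d)) c) → InSpan (L (eval d)) (Rctx (eval d) Ψ) B →
  IRDWithin (2 * W) (Gctx (eval d) Φ) B
decomposition⇒IRD {W = W} (atom g) k≤W _ _ Φ _ _ _ B _ = IRD-small (Gctx g Φ) B (≤-trans k≤W (m≤n*m W 2))
decomposition⇒IRD (tens d₁ d₂) d≤W a≤W b≤W Φ Ψ fL fR =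
  IRD-split splitting
    (decomposition⇒IRD d₁ (≤-trans (m≤m⊔n _ _) d≤W) a≤W b≤W Φ₁ Ψ₁ (L₁-factors fL) (Rctx₁-factors fR))
    (decomposition⇒IRD d₂ (≤-trans (m≤n⊔m _ _) d≤W) a≤W b≤W Φ₂ Ψ₂ (L₂-factors fL) (Rctx₂-factors fR))
    (InSpan⇒RankLe fL fR a≤W b≤W)
  where open Tensor (eval d₁) (eval d₂) Φ Ψ
decomposition⇒IRD (comp x d₁ d₂) d≤W a≤W b≤W Φ Ψ fL fR =
  IRD-split splitting
    (decomposition⇒IRD d₁ (≤-trans (≤-trans (m≤m⊔n _ _) (m≤m⊔n _ x)) d≤W) a≤W x≤W Φ zeroM
       (L₁-factors fL) (factorsThrough-cols _))
    (decomposition⇒IRD d₂ (≤-trans (≤-trans (m≤n⊔m _ _) (m≤m⊔n _ x)) d≤W) x≤W b≤W Φ₂ Ψ₂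
       (factorsThrough-cols _) (Rctx₂-factors fR))
    (InSpan⇒RankLe fL fR a≤W b≤W)
  where
  open Composite (eval d₁) (eval d₂) Φ Ψ
  x≤W = ≤-trans (m≤n⊔m _ x) d≤W

proposition5p25 : ∀ {n m} (g : Grph n m) (d : Dec n m) → eval d ≈ g →
    (rL rR : ℕ) → IsRank (L g) rL → IsRank (R g) rR →
    Σ (IRD (k g) (n + m) (G g) (L g ∣ R g))
      (λ T → IRDWidthLe T (2 * (width d ⊔ rL ⊔ rR)))
proposition5p25 g d (σ , G≈ , L≡ , R≡ , _ , _) rL rR (fL , _) (fR , _) =
  IRD-permute σ (λ i j → trans (sym (G≈ i j)) (sym (≈ᴳ-cong (Gctx-zero g′) i j)))
                (λ i a → sym (∣-cong L≡ R≡ i a)) T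
  where
  g′ = eval d
  fL′ : FactorsThrough (L g′) rL
  fL′ = FactorsThrough-reindex (σ ⟨$⟩ʳ_) (λ a → a) L≡ fL
  fR′ : FactorsThrough (Rctx g′ zeroM) rR
  fR′ = FactorsThrough-reindex (σ ⟨$⟩ʳ_) (λ a → a) (λ i a → trans (Rctx-zero g′ i a) (R≡ i a)) fR
  T = decomposition⇒IRD d (≤-trans (m≤m⊔n (width d) rL) (m≤m⊔n _ rR))
                          (≤-trans (m≤n⊔m (width d) rL) (m≤m⊔n _ rR)) (m≤n⊔m _ rR) zeroM zeroM fL′ fR′
                          (L g′ ∣ R g′) (InSpan-∣ InSpan-L (InSpan-cong (≋-sym (Rctx-zero g′)) InSpan-R))
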